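{- Let $G$ be a graph and $D$ an orientation of $G^{(2)}$. Let $k\ge 2$ and let $v_0v_1\dots v_k$ be a shortest $v_0$–$v_k$ path in $G$ (of length $k$). Suppose that (a) for some $i$ with $0\le i\le k-2$, we have $(2,v_{i+1})\to\{(1,v_i),(2,v_i)\}\to(1,v_{i+1})$ and $(1,v_{i+1})\to\{(1,v_{i+2}),(2,v_{i+2})\}\to(2,v_{i+1})$ in $D$; and (b) for every $j\in\{0,1,\dots,k-1\}\setminus\{i,i+1\}$, either $(1,v_j)\to(1,v_{j+1})\to(2,v_j)\to(2,v_{j+1})\to(1,v_j)$ in $D$, or $(1,v_{j+1})\to(1,v_j)\to(2,v_{j+1})\to(2,v_j)\to(1,v_{j+1})$ in $D$. Then $d_D((p,v_0),(q,v_k))=d_D((p,v_k),(q,v_0))=k$ for all $p,q\in\{1,2\}$.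
   Context: $G^{(2)}$ is the graph with vertex set $\{(1,u),(2,u): u\in V(G)\}$ in which $(a,u)$ and $(b,v)$ are adjacent iff $uv\in E(G)$. An orientation assigns a direction to each edge; $x\to y$ denotes the arc from $x$ to $y$, and $x\to\{y,z\}\to w$ means $x\to y$, $x\to z$, $y\to w$, $z\to w$. $d_D(x,y)$ is the length of a shortest directed path from $x$ to $y$ in $D$. -}

module Defs where

open import Data.Nat using (ℕ; zero; suc; _≤_; _<_)
open import Data.Fin using (Fin)
open import Data.Product using (_×_; _,_; ∃)
open import Data.Sum using (_⊎_)
open import Relation.Nullary using (¬_)

record Graph : Set₁ where
  field
    V    : Set
    Adj  : V → V → Set
    sym  : ∀ {u v} → Adj u v → Adj v u
    irr  : ∀ {u} → ¬ Adj u u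

data Walk {A : Set} (R : A → A → Set) : A → A → ℕ → Set where
  []  : ∀ {x} → Walk R x x zero
  _∷_ : ∀ {x y z n} → R x y → Walk R y z n → Walk R x z (suc n)

DistEq : {A : Set} (R : A → A → Set) → A → A → ℕ → Set
DistEq R x y k = Walk R x y k × (∀ n → Walk R x y n → k ≤ n)

-- The graph G^(2): vertices (a,u) with a ∈ Fin 2 (zero = copy 1, suc zero = copy 2);
-- (a,u) ~ (b,v) iff uv ∈ E(G).
V2 : Graph → Set
V2 G = Fin 2 × Graph.V G

Adj2 : (G : Graph) → V2 G → V2 G → Set
Adj2 G (a , u) (b , v) = Graph.Adj G u v

record IsOrientation2 (G : Graph) (D : V2 G → V2 G → Set) : Set where
  field
    arc⇒edge : ∀ {x y} → D x y → Adj2 G x y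
    edge⇒arc : ∀ {x y} → Adj2 G x y → D x y ⊎ D y x
    antisym  : ∀ {x y} → D x y → ¬ D y x

-- A shortest u–w path v 0, v 1, …, v k in G (of length k); only v 0 … v k are relevant.
IsShortestPath : (G : Graph) → (ℕ → Graph.V G) → ℕ → Set
IsShortestPath G v k =
  (∀ j → j < k → Graph.Adj G (v j) (v (suc j))) ×
  (∀ n → Walk (Graph.Adj G) (v 0) (v k) n → k ≤ n)

-- A directed walk of D projects to a walk of G of the same length, so no walk between copies
-- of v₀ and v_k is shorter than k.  For the upper bound, an alternating 4-cycle between the
-- copies of v_j and v_{j+1} matches the two copies bijectively in each direction, so along such
-- segments every copy at one end has a walk to some copy at the other end, and every copy at
-- the other end is reached from some copy.  At the hub, (1,v_{i+1}) is entered from both copies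
-- of v_i and exits to both copies of v_{i+2} (and (2,v_{i+1}) in the reverse direction), so
-- there a walk can switch to whichever copy it needs.
module Submission where

open import Defs
open import Data.Nat using (ℕ; zero; suc; _≤_; _<_; _+_; s≤s; z≤n)
open import Data.Nat.Properties
  using (+-comm; +-suc; m≤n+m; n<1+n; <-trans; <⇒≢; >⇒≢; m<n⇒m<1+n; +-monoˡ-<; m∸n+n≡m)
open import Data.Fin using (Fin)
open import Data.Product using (_×_; _,_; ∃; proj₁; proj₂; swap)
open import Data.Sum using (_⊎_; [_,_])
open import Function using (_∘_)
open import Relation.Binary.PropositionalEquality
  using (_≡_; _≢_; refl; sym; trans; cong; subst)

m≤n⇒∃[o]o+m≡n : ∀ {m n} → m ≤ n → ∃ λ o → o + m ≡ n
m≤n⇒∃[o]o+m≡n m≤n = _ , m∸n+n≡m m≤n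

module _ {A : Set} {R : A → A → Set} where

  infixr 5 _++ᵂ_

  _++ᵂ_ : ∀ {x y z n m} → Walk R x y n → Walk R y z m → Walk R x z (n + m)
  []      ++ᵂ w′ = w′
  (e ∷ w) ++ᵂ w′ = e ∷ (w ++ᵂ w′)

  Walk-snoc : ∀ {x y z n} → Walk R x y n → R y z → Walk R x z (suc n)
  Walk-snoc []      e′ = e′ ∷ []
  Walk-snoc (e ∷ w) e′ = e ∷ Walk-snoc w e′

  Walk-reverse : (∀ {x y} → R x y → R y x) → ∀ {x y n} → Walk R x y n → Walk R y x n
  Walk-reverse R-sym []      = []
  Walk-reverse R-sym (e ∷ w) = Walk-snoc (Walk-reverse R-sym w) (R-sym e)

Walk-map : ∀ {A B : Set} {R : A → A → Set} {S : B → B → Set} {f : A → B} →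
           (∀ {x y} → R x y → S (f x) (f y)) →
           ∀ {x y n} → Walk R x y n → Walk S (f x) (f y) n
Walk-map g []      = []
Walk-map g (e ∷ w) = g e ∷ Walk-map g w

Walk-project : ∀ {G D} → IsOrientation2 G D →
               ∀ {x y n} → Walk D x y n → Walk (Graph.Adj G) (proj₂ x) (proj₂ y) n
Walk-project O = Walk-map (IsOrientation2.arc⇒edge O)

module _ {L A : Set} (D : L × A → L × A → Set) where

  record Covers (n : ℕ) (u w : A) : Set where
    field
      from : ∀ p → ∃ λ q → Walk D (p , u) (q , w) n
      onto : ∀ q → ∃ λ p → Walk D (p , u) (q , w) n

  AllToAll : ℕ → A → A → Set
  AllToAll n u w = ∀ p q → Walk D (p , u) (q , w) n

module _ {L A : Set} {D : L × A → L × A → Set} where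

  open Covers

  Covers-refl : ∀ {u} → Covers D 0 u u
  Covers-refl = record { from = λ p → p , [] ; onto = λ q → q , [] }

  Covers-trans : ∀ {n m u w x} → Covers D n u w → Covers D m w x → Covers D (n + m) u x
  Covers-trans c c′ = record
    { from = λ p → let r , w₁ = from c p ; q , w₂ = from c′ r in q , w₁ ++ᵂ w₂
    ; onto = λ q → let r , w₂ = onto c′ q ; p , w₁ = onto c r in p , w₁ ++ᵂ w₂
    }

  Covers-along : (w : ℕ → A) (n : ℕ) →
                 (∀ j → j < n → Covers D 1 (w j) (w (suc j))) → Covers D n (w 0) (w n)
  Covers-along w zero    step = Covers-refl
  Covers-along w (suc n) step =
    Covers-trans (step 0 (s≤s z≤n))
                 (Covers-along (λ j → w (suc j)) n (λ j j<n → step (suc j) (s≤s j<n)))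

  Covers-along-reverse : (w : ℕ → A) (n : ℕ) →
                         (∀ j → j < n → Covers D 1 (w (suc j)) (w j)) → Covers D n (w n) (w 0)
  Covers-along-reverse w zero    step = Covers-refl
  Covers-along-reverse w (suc n) step =
    Covers-trans (step n (n<1+n n)) (Covers-along-reverse w n (λ j j<n → step j (m<n⇒m<1+n j<n)))

  AllToAll-through : ∀ {u w} (c : L × A) →
                     (∀ p → D (p , u) c) → (∀ q → D c (q , w)) → AllToAll D 2 u w
  AllToAll-through c into out p q = into p ∷ (out q ∷ [])

  AllToAll-extend : ∀ {n m l u w x y} →
                    Covers D n u w → AllToAll D m w x → Covers D l x y → AllToAll D (n + (m + l)) u y
  AllToAll-extend c a c′ p q =
    let r , w₁ = from c p ; s , w₃ = onto c′ q in w₁ ++ᵂ a r s ++ᵂ w₃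

  -- The length is written m + (i + 2) so that the part after the hub, indexed j + (i + 2),
  -- starts and ends at w (i + 2) and w k definitionally.
  AllToAll-along-path :
    (w : ℕ → A) (i m : ℕ) →
    (∀ j → j < m + suc (suc i) → j ≢ i → j ≢ suc i →
      Covers D 1 (w j) (w (suc j)) × Covers D 1 (w (suc j)) (w j)) →
    AllToAll D 2 (w i) (w (suc (suc i))) → AllToAll D 2 (w (suc (suc i))) (w i) →
    AllToAll D (m + suc (suc i)) (w 0) (w (m + suc (suc i))) ×
    AllToAll D (m + suc (suc i)) (w (m + suc (suc i))) (w 0)
  AllToAll-along-path w i m segment middle middle⁻¹ =
    subst (λ n → AllToAll D n (w 0) (w (m + suc (suc i)))) length
          (AllToAll-extend (proj₁ before) middle (proj₁ after))
    , AllToAll-extend (proj₂ after) middle⁻¹ (proj₂ before)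
    where
    i+1<j+i+2 : ∀ j → suc i < j + suc (suc i)
    i+1<j+i+2 j = m≤n+m (suc (suc i)) j

    segment-before : ∀ j → j < i →
                     Covers D 1 (w j) (w (suc j)) × Covers D 1 (w (suc j)) (w j)
    segment-before j j<i = segment j (<-trans j<i (<-trans (n<1+n i) (i+1<j+i+2 m)))
                                     (<⇒≢ j<i) (<⇒≢ (m<n⇒m<1+n j<i))

    w-after : ℕ → A
    w-after j = w (j + suc (suc i))

    segment-after : ∀ j → j < m →
                    Covers D 1 (w-after j) (w-after (suc j)) × Covers D 1 (w-after (suc j)) (w-after j)
    segment-after j j<m = segment (j + suc (suc i)) (+-monoˡ-< (suc (suc i)) j<m)
                                  (>⇒≢ (<-trans (n<1+n i) (i+1<j+i+2 j))) (>⇒≢ (i+1<j+i+2 j))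

    before : Covers D i (w 0) (w i) × Covers D i (w i) (w 0)
    before = Covers-along w i (λ j j<i → proj₁ (segment-before j j<i))
           , Covers-along-reverse w i (λ j j<i → proj₂ (segment-before j j<i))

    after : Covers D m (w (suc (suc i))) (w (m + suc (suc i))) ×
            Covers D m (w (m + suc (suc i))) (w (suc (suc i)))
    after = Covers-along w-after m (λ j j<m → proj₁ (segment-after j j<m))
          , Covers-along-reverse w-after m (λ j j<m → proj₂ (segment-after j j<m))

    length : i + (2 + m) ≡ m + suc (suc i)
    length = trans (+-comm i (2 + m)) (sym (trans (+-suc m (suc i)) (cong suc (+-suc m i))))

module _ {A : Set} (D : Fin 2 × A → Fin 2 × A → Set) where

  AlternatingSquare : A → A → Set
  AlternatingSquare u w =
    D (Fin.zero , u) (Fin.zero , w) × D (Fin.zero , w) (Fin.suc Fin.zero , u) ×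
    D (Fin.suc Fin.zero , u) (Fin.suc Fin.zero , w) × D (Fin.suc Fin.zero , w) (Fin.zero , u)

  AlternatingSquare⇒Covers : ∀ {u w} → AlternatingSquare u w → Covers D 1 u w × Covers D 1 w u
  AlternatingSquare⇒Covers (s₁ , s₂ , s₃ , s₄) = forward , backward
    where
    forward : Covers D 1 _ _
    forward = record
      { from = λ { Fin.zero → Fin.zero , s₁ ∷ [] ; (Fin.suc Fin.zero) → Fin.suc Fin.zero , s₃ ∷ [] }
      ; onto = λ { Fin.zero → Fin.zero , s₁ ∷ [] ; (Fin.suc Fin.zero) → Fin.suc Fin.zero , s₃ ∷ [] }
      }
    backward : Covers D 1 _ _
    backward = record
      { from = λ { Fin.zero → Fin.suc Fin.zero , s₂ ∷ [] ; (Fin.suc Fin.zero) → Fin.zero , s₄ ∷ [] }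
      ; onto = λ { Fin.zero → Fin.suc Fin.zero , s₄ ∷ [] ; (Fin.suc Fin.zero) → Fin.zero , s₂ ∷ [] }
      }

  AlternatingSquare⊎⇒Covers : ∀ {u w} → AlternatingSquare u w ⊎ AlternatingSquare w u →
                              Covers D 1 u w × Covers D 1 w u
  AlternatingSquare⊎⇒Covers = [ AlternatingSquare⇒Covers , swap ∘ AlternatingSquare⇒Covers ]

lemma3p2 : (G : Graph) (D : V2 G → V2 G → Set) → IsOrientation2 G D →
    (k : ℕ) → 2 ≤ k → (v : ℕ → Graph.V G) → IsShortestPath G v k →
    (i : ℕ) → i + 2 ≤ k →
    -- (a)  (2,v_{i+1}) → {(1,v_i),(2,v_i)} → (1,v_{i+1})
    (D (Fin.suc Fin.zero , v (suc i)) (Fin.zero , v i) ×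
     D (Fin.suc Fin.zero , v (suc i)) (Fin.suc Fin.zero , v i) ×
     D (Fin.zero , v i) (Fin.zero , v (suc i)) ×
     D (Fin.suc Fin.zero , v i) (Fin.zero , v (suc i))) →
    --      (1,v_{i+1}) → {(1,v_{i+2}),(2,v_{i+2})} → (2,v_{i+1})
    (D (Fin.zero , v (suc i)) (Fin.zero , v (suc (suc i))) ×
     D (Fin.zero , v (suc i)) (Fin.suc Fin.zero , v (suc (suc i))) ×
     D (Fin.zero , v (suc (suc i))) (Fin.suc Fin.zero , v (suc i)) ×
     D (Fin.suc Fin.zero , v (suc (suc i))) (Fin.suc Fin.zero , v (suc i))) →
    -- (b)
    (∀ j → j < k → j ≢ i → j ≢ suc i →
      (D (Fin.zero , v j) (Fin.zero , v (suc j)) ×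
       D (Fin.zero , v (suc j)) (Fin.suc Fin.zero , v j) ×
       D (Fin.suc Fin.zero , v j) (Fin.suc Fin.zero , v (suc j)) ×
       D (Fin.suc Fin.zero , v (suc j)) (Fin.zero , v j))
      ⊎
      (D (Fin.zero , v (suc j)) (Fin.zero , v j) ×
       D (Fin.zero , v j) (Fin.suc Fin.zero , v (suc j)) ×
       D (Fin.suc Fin.zero , v (suc j)) (Fin.suc Fin.zero , v j) ×
       D (Fin.suc Fin.zero , v j) (Fin.zero , v (suc j)))) →
    (p q : Fin 2) →
    DistEq D (p , v 0) (q , v k) k × DistEq D (p , v k) (q , v 0) k
lemma3p2 G D O k _ v (_ , shortest) i i+2≤k (a₁ , a₂ , a₃ , a₄) (c₁ , c₂ , c₃ , c₄) squares p q
  with m , refl ← m≤n⇒∃[o]o+m≡n (subst (_≤ k) (+-comm i 2) i+2≤k)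
  = (proj₁ paths p q , λ n w → shortest n (Walk-project O w))
  , (proj₂ paths p q , λ n w → shortest n (Walk-reverse (Graph.sym G) (Walk-project O w)))
  where
  middle : AllToAll D 2 (v i) (v (suc (suc i)))
  middle = AllToAll-through {D = D} (Fin.zero , v (suc i))
    (λ { Fin.zero → a₃ ; (Fin.suc Fin.zero) → a₄ }) (λ { Fin.zero → c₁ ; (Fin.suc Fin.zero) → c₂ })

  middle⁻¹ : AllToAll D 2 (v (suc (suc i))) (v i)
  middle⁻¹ = AllToAll-through {D = D} (Fin.suc Fin.zero , v (suc i))
    (λ { Fin.zero → c₃ ; (Fin.suc Fin.zero) → c₄ }) (λ { Fin.zero → a₁ ; (Fin.suc Fin.zero) → a₂ })

  paths : AllToAll D (m + suc (suc i)) (v 0) (v (m + suc (suc i))) ×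
          AllToAll D (m + suc (suc i)) (v (m + suc (suc i))) (v 0)
  paths = AllToAll-along-path v i m
    (λ j j<k j≢i j≢1+i → AlternatingSquare⊎⇒Covers D (squares j j<k j≢i j≢1+i))
    middle middle⁻¹
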